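{- Let $b, c$ be non-zero integers such that: (1) $b \geq -2$; (2) $3 \nmid bc$; (3) if $b$ is even, then $c$ is even; (4) if $b$ is odd and there exist positive integers $x$ and $k$ with $2 \cdot 3^k < 2^x < 3^{k+1}$, $2^x \leq |b|$, and $(b \bmod 2^x) \equiv 0 \pmod 3$, then $c$ is even; (5) for every prime $p$ such that $2 \cdot 3^k < p < 3^{k+1}$ for some positive integer $k$, $p \leq |b|$, and $(b \bmod p) \equiv 0 \pmod 3$, we have $p \mid c$. Let $q_t(n) = 3c n^2 + bc n$ for $n \geq 0$. Then $D_{q_t}(n) = 3^{\lceil \log_3 n \rceil}$ for all integers $n \geq 1$.
   Context: For integers $a$ and $N \geq 1$, $a \bmod N$ denotes the least non-negative residue of $a$ modulo $N$. For an integer sequence $s = (s(i))_{i \geq 0}$ and an integer $n \geq 1$, the discriminator $D_s(n)$ is the least positive integer $m$ such that $s(0), \ldots, s(n-1)$ are pairwise incongruent modulo $m$. -}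

module Defs where

open import Data.Nat as ℕ using (ℕ; zero; suc; _^_; _≤_; _<_; _≤ᵇ_)
open import Data.Integer as ℤ using (ℤ; +_; _-_)
open import Data.Integer.DivMod using (_%ℕ_)
open import Data.Integer.Divisibility as ℤD using ()
open import Data.Bool using (if_then_else_)
open import Data.Product using (_×_)
open import Relation.Nullary using (¬_)

-- least non-negative residue a mod N, for N ≥ 1 (value at N = 0 is irrelevant; set to 0)
_modN_ : ℤ → ℕ → ℕ
a modN zero = 0
a modN suc k = a %ℕ suc k

_≡_[mod_] : ℤ → ℤ → ℕ → Set
a ≡ b [mod m ] = (+ m) ℤD.∣ (a - b)

PairwiseIncongruent : (ℕ → ℤ) → ℕ → ℕ → Set
PairwiseIncongruent s n m =
  ∀ i j → i < n → j < n → i < j → ¬ (s i ≡ s j [mod m ])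

IsDiscriminator : (ℕ → ℤ) → ℕ → ℕ → Set
IsDiscriminator s n m =
  1 ≤ m × PairwiseIncongruent s n m
  × (∀ m' → 1 ≤ m' → m' < m → ¬ PairwiseIncongruent s n m')

-- ⌈log₃ n⌉ : least e with n ≤ 3^e (searching e = 0,1,…,fuel; fuel = n suffices)
clog3-search : ℕ → ℕ → ℕ → ℕ
clog3-search n e zero = e
clog3-search n e (suc fuel) = if n ≤ᵇ 3 ^ e then e else clog3-search n (suc e) fuel

⌈log₃_⌉ : ℕ → ℕ
⌈log₃ n ⌉ = clog3-search n 0 n

qt : ℤ → ℤ → ℕ → ℤ
qt b c n = ℤ.+ 3 ℤ.* c ℤ.* (+ n) ℤ.* (+ n) ℤ.+ b ℤ.* c ℤ.* (+ n)

-- Since q_t(i + d) − q_t(i) = c·d·(3(2i + d) + b) and 3 divides neither c nor 3(2i + d) + b ≡ b,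
-- two of q_t(0), …, q_t(n − 1) can only agree modulo 3^e when 3^e divides their distance,
-- so they are incongruent modulo 3^⌈log₃ n⌉. For minimality it suffices, writing K = 3^k < n,
-- to find for every m with K < m < 3K some i < i + d ≤ K with m ∣ c·d·(3(2i + d) + b).
-- Split m = d·r with r prime to 6 (or r = 2h with 3d + b even) and solve the linear congruence
-- for i modulo r; an elementary size estimate puts i + d below K. The estimate fails only when m
-- is a prime, twice a prime, or (for odd b) a power of 2. There the root s = 2i + d of 3s + b ≡ 0
-- is either below 2K, or it lies in [2K, m] and forces 3 ∣ (b mod m) and m ≤ |b|; that is
-- exactly the situation in which hypotheses (4) and (5) make c supply the missing factor.
module Submission where

open import Defs
open import Data.Nat as ℕ using (ℕ; _^_; _≤_; _<_)
open import Data.Nat.Primality using (Prime)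
open import Data.Integer as ℤ using (ℤ; +_; -[1+_]; ∣_∣)
open import Data.Integer.Divisibility as ℤD using ()
open import Data.Nat.Divisibility as ℕD using ()
open import Data.Product using (_×_; ∃-syntax)
open import Relation.Nullary using (¬_)
open import Relation.Binary.PropositionalEquality using (_≢_)

open import Data.Bool using (true; false; T)
open import Data.Integer.DivMod using (_%ℕ_; _/ℕ_; n%ℕd<d; a≡a%ℕn+[a/ℕn]*n)
open import Data.Integer.Divisibility.Signed as ℤ∣ using () renaming (_∣_ to _∣ℤ_)
open import Data.Integer.Properties as ℤP using (pos-+; pos-*; abs-*; ∣-i∣≡∣i∣)
open import Data.Integer.Tactic.RingSolver using () renaming (solve-∀ to solve-∀ℤ)
open import Data.List.Base using ([]; _∷_)
open import Data.List.Relation.Unary.All using (All; []; _∷_)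
open import Data.Nat using (zero; suc; _+_; _*_; _∸_; _≰_; _<?_; _≤?_; z≤n; s≤s; NonZero; nonTrivial⇒≢1)
open import Data.Nat.DivMod using (_%_; _/_; m≡m%n+[m/n]*n; m%n<n; m<n⇒m%n≡m)
open import Data.Nat.Divisibility
open import Data.Nat.ListAction using (product)
open import Data.Nat.Primality
  using (composite; composite[4]; composite⇒¬prime; euclidsLemma; prime?; prime[2]; prime⇒nonTrivial; prime⇒nonZero)
open import Data.Nat.Primality.Factorisation using (factorise)
open import Data.Nat.Properties
open import Data.Nat.Tactic.RingSolver using (solve-∀)
open import Data.Product using (_,_; proj₁; proj₂; map₂)
open import Data.Sum using (_⊎_; inj₁; inj₂)
open import Function using (_∘_; _$_)
open import Relation.Nullary using (contradiction; yes; no)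
open import Relation.Nullary.Decidable using (toWitness; toWitnessFalse)
open import Relation.Binary.PropositionalEquality
open import Algebra.Properties.CommutativeSemigroup *-commutativeSemigroup using (x∙yz≈y∙xz; xy∙z≈xz∙y; interchange)

-- Divisibility and primes

prime^∣*⇒∣ : ∀ {p} a d e → Prime p → ¬ p ∣ a → p ^ e ∣ a * d → p ^ e ∣ d
prime^∣*⇒∣ a d zero _ _ _ = 1∣ d
prime^∣*⇒∣ {p} a d (suc e) pp p∤a pᵉ⁺¹∣ad
  with euclidsLemma a d pp (∣-trans (m∣m*n (p ^ e)) pᵉ⁺¹∣ad)
... | inj₁ p∣a = contradiction p∣a p∤a
... | inj₂ (divides d′ refl) = subst (p ^ suc e ∣_) (*-comm p d′) (*-monoʳ-∣ p pᵉ∣d′)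
  where
  rearrange : ∀ a d′ p → a * (d′ * p) ≡ p * (a * d′)
  rearrange = solve-∀
  pᵉ∣d′ : p ^ e ∣ d′
  pᵉ∣d′ = prime^∣*⇒∣ a d′ e pp p∤a
    (*-cancelˡ-∣ p {{prime⇒nonZero pp}} (subst (p ^ suc e ∣_) (rearrange a d′ p) pᵉ⁺¹∣ad))

1<d<p⇒d∤p : ∀ {p d} → Prime p → 1 < d → d < p → ¬ d ∣ p
1<d<p⇒d∤p {d = suc (suc _)} pp _ d<p d∣p = Prime.notComposite pp (composite d<p d∣p)
1<d<p⇒d∤p {d = 1} _ (s≤s ()) _ _

∤⇒∤^ : ∀ {p q} → Prime p → ¬ p ∣ q → ∀ k → ¬ p ∣ q ^ k
∤⇒∤^ pp p∤q zero p∣1 = nonTrivial⇒≢1 {{prime⇒nonTrivial pp}} (∣1⇒≡1 p∣1)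
∤⇒∤^ {q = q} pp p∤q (suc k) p∣qᵏ⁺¹ with euclidsLemma q (q ^ k) pp p∣qᵏ⁺¹
... | inj₁ p∣q = p∤q p∣q
... | inj₂ p∣qᵏ = ∤⇒∤^ pp p∤q k p∣qᵏ

prime[3] : Prime 3
prime[3] = toWitness {a? = prime? 3} _

¬2∣3^ : ∀ k → ¬ 2 ∣ 3 ^ k
¬2∣3^ = ∤⇒∤^ prime[2] (toWitnessFalse {a? = 2 ∣? 3} _)

¬3∣2^ : ∀ w → ¬ 3 ∣ 2 ^ w
¬3∣2^ = ∤⇒∤^ prime[3] (toWitnessFalse {a? = 3 ∣? 2} _)

¬2∣⇒odd : ∀ n → ¬ 2 ∣ n → ∃[ h ] n ≡ 1 + 2 * h
¬2∣⇒odd 0 2∤0 = contradiction (2 ∣0) 2∤0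
¬2∣⇒odd 1 _ = 0 , refl
¬2∣⇒odd (suc (suc n)) 2∤2+n with ¬2∣⇒odd n (2∤2+n ∘ ∣m∣n⇒∣m+n ∣-refl)
... | h , refl = suc h , cong suc (sym (*-suc 2 h))

prime≡2∨≡3∨≥5 : ∀ {p} → Prime p → p ≡ 2 ⊎ p ≡ 3 ⊎ 5 ≤ p
prime≡2∨≡3∨≥5 {2} _ = inj₁ refl
prime≡2∨≡3∨≥5 {3} _ = inj₂ (inj₁ refl)
prime≡2∨≡3∨≥5 {4} p4 = contradiction p4 (composite⇒¬prime composite[4])
prime≡2∨≡3∨≥5 {suc (suc (suc (suc (suc _))))} _ = inj₂ (inj₂ (s≤s (s≤s (s≤s (s≤s (s≤s z≤n))))))

prime≥5⇒¬2∣ : ∀ {p} → Prime p → 5 ≤ p → ¬ 2 ∣ p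
prime≥5⇒¬2∣ pp 5≤p = 1<d<p⇒d∤p pp (s≤s (s≤s z≤n)) (≤-trans (s≤s (s≤s (s≤s z≤n))) 5≤p)

prime≥5⇒¬3∣ : ∀ {p} → Prime p → 5 ≤ p → ¬ 3 ∣ p
prime≥5⇒¬3∣ pp 5≤p = 1<d<p⇒d∤p pp (s≤s (s≤s z≤n)) (≤-trans (s≤s (s≤s (s≤s (s≤s z≤n)))) 5≤p)

prime∣∧∣⇒*∣ : ∀ {q p x} → Prime q → ¬ q ∣ p → q ∣ x → p ∣ x → q * p ∣ x
prime∣∧∣⇒*∣ {q} {p} pq q∤p q∣x (divides y refl) with euclidsLemma y p pq q∣x
... | inj₂ q∣p = contradiction q∣p q∤p
... | inj₁ (divides z refl) = divides z (*-assoc z q p)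

3-Smooth : ℕ → Set
3-Smooth m = ∃[ w ] ∃[ a ] m ≡ 2 ^ w * 3 ^ a

HasPrimeFactor≥5 : ℕ → Set
HasPrimeFactor≥5 m = ∃[ p ] (Prime p × 5 ≤ p × p ∣ m)

3-smooth⊎hasPrimeFactor≥5 : ∀ m → .{{NonZero m}} → 3-Smooth m ⊎ HasPrimeFactor≥5 m
3-smooth⊎hasPrimeFactor≥5 m with factorise m
... | record { factors = ps ; isFactorisation = refl ; factorsPrime = primes } = product-case primes
  where
  product-case : ∀ {ps} → All Prime ps → 3-Smooth (product ps) ⊎ HasPrimeFactor≥5 (product ps)
  product-case [] = inj₁ (0 , 0 , refl)
  product-case {x ∷ ps} (px ∷ pxs) with prime≡2∨≡3∨≥5 px | product-case pxs
  ... | _ | inj₂ (p , pp , 5≤p , p∣) = inj₂ (p , pp , 5≤p , ∣n⇒∣m*n x p∣)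
  ... | inj₂ (inj₂ 5≤x) | _ = inj₂ (x , px , 5≤x , m∣m*n (product ps))
  ... | inj₁ refl | inj₁ (w , a , eq) = inj₁ (suc w , a , trans (cong (2 *_) eq) (sym (*-assoc 2 (2 ^ w) (3 ^ a))))
  ... | inj₂ (inj₁ refl) | inj₁ (w , a , eq) = inj₁ (w , suc a , trans (cong (3 *_) eq) (x∙yz≈y∙xz 3 (2 ^ w) (3 ^ a)))

-- Size estimates

^-cancelʳ-< : ∀ m .{{_ : NonZero m}} {a b} → m ^ a < m ^ b → a < b
^-cancelʳ-< m {a} {b} mᵃ<mᵇ with a <? b
... | yes a<b = a<b
... | no a≮b = contradiction (^-monoʳ-≤ m (≮⇒≥ a≮b)) (<⇒≱ mᵃ<mᵇ)

3^<3^[1+k]⇒≤3^k : ∀ {a k} → 3 ^ a < 3 * 3 ^ k → 3 ^ a ≤ 3 ^ k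
3^<3^[1+k]⇒≤3^k {a} {k} lt = ^-monoʳ-≤ 3 (≤-pred (^-cancelʳ-< 3 {a} {suc k} lt))

2*3^k<x<3^[1+k]⇒1≤k : ∀ {k x} → 2 * 3 ^ k < x → x < 3 * 3 ^ k → 1 ≤ k
2*3^k<x<3^[1+k]⇒1≤k {zero} 2<x x<3 = contradiction 2<x (<⇒≱ x<3)
2*3^k<x<3^[1+k]⇒1≤k {suc k} _ _ = s≤s z≤n

4*x<3*K⇒x<K : ∀ {x K} → 4 * x < 3 * K → x < K
4*x<3*K⇒x<K {x} {K} lt = *-cancelˡ-< 4 x K (<-≤-trans lt (*-monoˡ-≤ K (n≤1+n 3)))

2*x<3*K⇒x<2*K : ∀ {x K} → 2 * x < 3 * K → x < 2 * K
2*x<3*K⇒x<2*K {x} {K} lt =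
  *-cancelˡ-< 2 x (2 * K) (<-≤-trans lt (≤-trans (*-monoˡ-≤ K (n≤1+n 3)) (≤-reflexive (*-assoc 2 2 K))))

a*[x+y]≤x*y+a*a : ∀ {a x y} → a ≤ x → a ≤ y → a * (x + y) ≤ x * y + a * a
a*[x+y]≤x*y+a*a {a} a≤x a≤y with m≤n⇒∃[o]m+o≡n a≤x | m≤n⇒∃[o]m+o≡n a≤y
... | x′ , refl | y′ , refl = m+n≤o⇒m≤o (a * ((a + x′) + (a + y′))) (≤-reflexive (expand a x′ y′))
  where
  expand : ∀ a x′ y′ → a * ((a + x′) + (a + y′)) + x′ * y′ ≡ (a + x′) * (a + y′) + a * a
  expand = solve-∀

sum≤1+product : ∀ {x y} → 1 ≤ x → 1 ≤ y → x + y ≤ suc (x * y)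
sum≤1+product {x} {y} 1≤x 1≤y = begin
  x + y         ≡⟨ *-identityˡ (x + y) ⟨
  1 * (x + y)   ≤⟨ a*[x+y]≤x*y+a*a 1≤x 1≤y ⟩
  x * y + 1     ≡⟨ +-comm (x * y) 1 ⟩
  suc (x * y)   ∎
  where open ≤-Reasoning

2*h*d<3*K⇒h+d≤1+K : ∀ {h d K} → 2 ≤ h → 2 ≤ d → 2 * h * d < 3 * K → h + d ≤ suc K
2*h*d<3*K⇒h+d≤1+K {h} {d} {K} 2≤h 2≤d lt = ≤-pred (*-cancelˡ-< 8 (h + d) (2 + K) (begin-strict
  8 * (h + d)                ≡⟨ regroup h d ⟩
  4 * (2 * h + 2 * d)        ≤⟨ a*[x+y]≤x*y+a*a (*-monoʳ-≤ 2 2≤h) (*-monoʳ-≤ 2 2≤d) ⟩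
  2 * h * (2 * d) + 4 * 4    ≡⟨ regroup′ h d ⟩
  2 * suc (2 * h * d) + 14   ≤⟨ +-monoˡ-≤ 14 (*-monoʳ-≤ 2 lt) ⟩
  2 * (3 * K) + 14           <⟨ m+n≤o⇒m≤o _ (≤-reflexive (slack K)) ⟩
  8 * (2 + K)                ∎))
  where
  open ≤-Reasoning
  regroup : ∀ h d → 8 * (h + d) ≡ 4 * (2 * h + 2 * d)
  regroup = solve-∀
  regroup′ : ∀ h d → 2 * h * (2 * d) + 4 * 4 ≡ 2 * suc (2 * h * d) + 14
  regroup′ = solve-∀
  slack : ∀ K → suc (2 * (3 * K) + 14) + (1 + 2 * K) ≡ 8 * (2 + K)
  slack = solve-∀

u*p<3*K⇒u+p≤1+K : ∀ {u p K} → 8 ≤ K → 4 ≤ u → 4 ≤ p → u * p < 3 * K → u + p ≤ suc K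
u*p<3*K⇒u+p≤1+K {u} {p} {K} 8≤K 4≤u 4≤p lt = ≤-pred (*-cancelˡ-< 4 (u + p) (2 + K) (begin-strict
  4 * (u + p)         ≤⟨ a*[x+y]≤x*y+a*a 4≤u 4≤p ⟩
  u * p + 16          <⟨ +-monoˡ-< 16 lt ⟩
  3 * K + 16          ≡⟨ +-assoc (3 * K) 8 8 ⟨
  3 * K + 8 + 8       ≤⟨ +-monoʳ-≤ (3 * K + 8) 8≤K ⟩
  3 * K + 8 + K       ≡⟨ regroup K ⟩
  4 * (2 + K)         ∎))
  where
  open ≤-Reasoning
  regroup : ∀ K → 3 * K + 8 + K ≡ 4 * (2 + K)
  regroup = solve-∀

3*p<3*K⇒3+p≤1+K : ∀ {p K} → ¬ 2 ∣ p → ¬ 2 ∣ K → 3 * p < 3 * K → 3 + p ≤ suc K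
3*p<3*K⇒3+p≤1+K {p} {K} 2∤p 2∤K lt = s≤s (≤∧≢⇒< (*-cancelˡ-< 3 p K lt) 1+p≢K)
  where
  1+p≢K : suc p ≢ K
  1+p≢K refl with ¬2∣⇒odd p 2∤p
  ... | h , refl = 2∤K (divides (suc h) (cong (_+_ 2) (*-comm 2 h)))

u*p<3^[1+k]⇒u+p≤1+3^k : ∀ k {u p} → 3 ≤ u → 5 ≤ p → ¬ 2 ∣ p → u * p < 3 * 3 ^ k → u + p ≤ suc (3 ^ k)
u*p<3^[1+k]⇒u+p≤1+3^k k {u} {p} 3≤u 5≤p 2∤p lt with m≤n⇒m<n∨m≡n 3≤u
... | inj₂ refl = 3*p<3*K⇒3+p≤1+K 2∤p (¬2∣3^ k) lt
... | inj₁ 4≤u = u*p<3*K⇒u+p≤1+K 8≤3ᵏ 4≤u (≤-trans (n≤1+n 4) 5≤p) lt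
  where
  3<3ᵏ : 3 ^ 1 < 3 ^ k
  3<3ᵏ = ≰⇒> λ 3ᵏ≤3 → <⇒≱ lt (≤-trans (*-monoʳ-≤ 3 3ᵏ≤3) (≤-trans (m≤m+n 9 11) (*-mono-≤ 4≤u 5≤p)))
  8≤3ᵏ : 8 ≤ 3 ^ k
  8≤3ᵏ = ≤-trans (n≤1+n 8) (^-monoʳ-≤ 3 {2} {k} (^-cancelʳ-< 3 {1} {k} 3<3ᵏ))

2*2^w*3^[1+a]<3^[1+k]⇒3^[1+a]+2^w≤1+3^k : ∀ k w a → 2 * 2 ^ w * 3 ^ suc a < 3 * 3 ^ k → 3 ^ suc a + 2 ^ w ≤ suc (3 ^ k)
2*2^w*3^[1+a]<3^[1+k]⇒3^[1+a]+2^w≤1+3^k k zero a lt =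
  subst (_≤ suc (3 ^ k)) (+-comm 1 (3 ^ suc a)) (s≤s (3^<3^[1+k]⇒≤3^k {suc a} {k} (≤-<-trans (m≤n*m (3 ^ suc a) 2) lt)))
2*2^w*3^[1+a]<3^[1+k]⇒3^[1+a]+2^w≤1+3^k k (suc w) a lt = subst (_≤ suc (3 ^ k)) (+-comm (2 ^ suc w) (3 ^ suc a))
  (2*h*d<3*K⇒h+d≤1+K (*-monoʳ-≤ 2 (m^n>0 2 w)) (≤-trans (n≤1+n 2) (*-monoʳ-≤ 3 (m^n>0 3 a))) lt)

8*x*y<3*K⇒2*y+x≤1+K : ∀ {K} x y → 1 ≤ x → 1 ≤ y → 2 * (2 * (2 * x)) * y < 3 * K → 2 * y + x ≤ suc K
8*x*y<3*K⇒2*y+x≤1+K {K} x y 1≤x 1≤y lt = begin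
  2 * y + x          ≤⟨ sum≤1+product (≤-trans 1≤y (m≤n*m y 2)) 1≤x ⟩
  suc (2 * y * x)    ≤⟨ 4*x<3*K⇒x<K (subst (_< 3 * K) (regroup x y) lt) ⟩
  K                  ≤⟨ n≤1+n K ⟩
  suc K              ∎
  where
  open ≤-Reasoning
  regroup : ∀ x y → 2 * (2 * (2 * x)) * y ≡ 4 * (2 * y * x)
  regroup = solve-∀

split-sum : ∀ {s K} → 1 ≤ s → s < 2 * K → ∃[ i ] ∃[ d ] ((d ≡ 1 ⊎ d ≡ 2) × s ≡ d + 2 * i × i + d ≤ K)
split-sum {s} {K} 1≤s s<2K with 2 ∣? s
... | no 2∤s with ¬2∣⇒odd s 2∤s
...   | i , refl = i , 1 , inj₁ refl , refl , subst (_≤ K) (+-comm 1 i) (*-cancelˡ-< 2 i K (≤-trans (n≤1+n _) s<2K))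
split-sum {s} {K} 1≤s s<2K | yes (divides zero refl) = contradiction 1≤s λ ()
split-sum {s} {K} 1≤s s<2K | yes (divides (suc i) refl) =
  i , 2 , inj₂ refl , trans (*-comm (suc i) 2) (*-suc 2 i) ,
  subst (_≤ K) (+-comm 2 i) (*-cancelˡ-< 2 (suc i) K (subst (_< 2 * K) (*-comm (suc i) 2) s<2K))

i<r⇒d+r≤1+K⇒i+d≤K : ∀ {i d r K} → i < r → d + r ≤ suc K → i + d ≤ K
i<r⇒d+r≤1+K⇒i+d≤K {i} {d} {r} i<r d+r≤1+K =
  ≤-pred (≤-trans (subst (_≤ d + r) (+-comm d (suc i)) (+-monoʳ-≤ d i<r)) d+r≤1+K)

n≤3^n : ∀ n → n ≤ 3 ^ n
n≤3^n zero = z≤n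
n≤3^n (suc n) = begin
  1 + n                   ≤⟨ +-mono-≤ (m^n>0 3 n) (n≤3^n n) ⟩
  3 ^ n + 3 ^ n           ≤⟨ m≤m+n (3 ^ n + 3 ^ n) (3 ^ n) ⟩
  3 ^ n + 3 ^ n + 3 ^ n   ≡⟨ regroup (3 ^ n) ⟩
  3 * 3 ^ n               ∎
  where
  open ≤-Reasoning
  regroup : ∀ x → x + x + x ≡ 3 * x
  regroup = solve-∀

PreviousPowerBelow : ℕ → ℕ → Set
PreviousPowerBelow n e = ∀ {k} → e ≡ suc k → 3 ^ k < n

clog3-search-spec : ∀ n e fuel → PreviousPowerBelow n e → n ≤ 3 ^ (e + fuel)
                  → n ≤ 3 ^ clog3-search n e fuel × PreviousPowerBelow n (clog3-search n e fuel)
clog3-search-spec n e zero below n≤ = subst (λ x → n ≤ 3 ^ x) (+-identityʳ e) n≤ , below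
clog3-search-spec n e (suc fuel) below n≤ with n ℕ.≤ᵇ 3 ^ e in eq
... | true = ≤ᵇ⇒≤ n (3 ^ e) (subst T (sym eq) _) , below
... | false = clog3-search-spec n (suc e) fuel 3ᵉ<n (subst (λ x → n ≤ 3 ^ x) (+-suc e fuel) n≤)
  where
  3ᵉ<n : PreviousPowerBelow n (suc e)
  3ᵉ<n refl = ≰⇒> (λ n≤3ᵉ → subst T eq (≤⇒≤ᵇ n≤3ᵉ))

n≤3^⌈log₃n⌉ : ∀ n → n ≤ 3 ^ ⌈log₃ n ⌉
n≤3^⌈log₃n⌉ n = proj₁ (clog3-search-spec n 0 n (λ ()) (n≤3^n n))

⌈log₃n⌉-minimal : ∀ n → PreviousPowerBelow n ⌈log₃ n ⌉
⌈log₃n⌉-minimal n = proj₂ (clog3-search-spec n 0 n (λ ()) (n≤3^n n))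

-- Linear congruences

record HasInverseMod (a r : ℕ) : Set where
  constructor inverseMod
  field
    inverse multiple : ℕ
    equation : a * inverse ≡ 1 + r * multiple

inverse-* : ∀ {a a′ r} → HasInverseMod a r → HasInverseMod a′ r → HasInverseMod (a * a′) r
inverse-* {a} {a′} {r} (inverseMod u e au≡1+re) (inverseMod u′ e′ a′u′≡1+re′) =
  inverseMod (u * u′) (e + e′ + r * e * e′) (begin
  a * a′ * (u * u′)          ≡⟨ interchange a a′ u u′ ⟩
  (a * u) * (a′ * u′)        ≡⟨ cong₂ _*_ au≡1+re a′u′≡1+re′ ⟩
  (1 + r * e) * (1 + r * e′) ≡⟨ expand r e e′ ⟩
  1 + r * (e + e′ + r * e * e′) ∎)
  where
  open ≡-Reasoning
  expand : ∀ r e e′ → (1 + r * e) * (1 + r * e′) ≡ 1 + r * (e + e′ + r * e * e′)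
  expand = solve-∀

inverse-2 : ∀ h → HasInverseMod 2 (1 + 2 * h)
inverse-2 h = inverseMod (suc h) 1 (identity h)
  where
  identity : ∀ h → 2 * suc h ≡ 1 + (1 + 2 * h) * 1
  identity = solve-∀

¬3∣⇒inverse-3 : ∀ {r} → ¬ 3 ∣ r → HasInverseMod 3 r
¬3∣⇒inverse-3 {r} 3∤r with r % 3 | m≡m%n+[m/n]*n r 3 | m%n<n r 3
... | 0 | r≡0+t*3 | _ = contradiction (divides (r / 3) r≡0+t*3) 3∤r
... | 1 | r≡1+t*3 | _ = inverseMod (1 + 2 * (r / 3)) 2 $ trans (residue-1 (r / 3)) (cong (λ x → 1 + x * 2) (sym r≡1+t*3))
  where
  residue-1 : ∀ t → 3 * (1 + 2 * t) ≡ 1 + (1 + t * 3) * 2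
  residue-1 = solve-∀
... | 2 | r≡2+t*3 | _ = inverseMod (1 + r / 3) 1 $ trans (residue-2 (r / 3)) (cong (λ x → 1 + x * 1) (sym r≡2+t*3))
  where
  residue-2 : ∀ t → 3 * (1 + t) ≡ 1 + (2 + t * 3) * 1
  residue-2 = solve-∀
... | suc (suc (suc _)) | _ | s≤s (s≤s (s≤s ()))

-- The root is i = (−A·u) mod r, where u is the inverse of a.
solve-linear-congruence : ∀ {a} r .{{_ : NonZero r}} → HasInverseMod a r → (A : ℤ)
                        → ∃[ i ] (i < r × + r ∣ℤ + a ℤ.* + i ℤ.+ A)
solve-linear-congruence {a} r (inverseMod u e au≡1+re) A =
  i , n%ℕd<d z r , ℤ∣.divides (ℤ.- (A ℤ.* + e) ℤ.- + a ℤ.* q) (begin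
    + a ℤ.* + i ℤ.+ A
      ≡⟨ cong (λ x → + a ℤ.* x ℤ.+ A) i≡z-qr ⟩
    + a ℤ.* (z ℤ.- q ℤ.* + r) ℤ.+ A
      ≡⟨ expand A (+ u) (+ a) q (+ r) ⟩
    ℤ.- (A ℤ.* (+ a ℤ.* + u)) ℤ.- + a ℤ.* q ℤ.* + r ℤ.+ A
      ≡⟨ cong (λ x → ℤ.- (A ℤ.* x) ℤ.- + a ℤ.* q ℤ.* + r ℤ.+ A) au≡1+reℤ ⟩
    ℤ.- (A ℤ.* (+ 1 ℤ.+ + r ℤ.* + e)) ℤ.- + a ℤ.* q ℤ.* + r ℤ.+ A
      ≡⟨ collect A (+ a) q (+ r) (+ e) ⟩
    (ℤ.- (A ℤ.* + e) ℤ.- + a ℤ.* q) ℤ.* + r ∎)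
  where
  open ≡-Reasoning
  z = ℤ.- (A ℤ.* + u)
  i = z %ℕ r
  q = z /ℕ r
  i≡z-qr : + i ≡ z ℤ.- q ℤ.* + r
  i≡z-qr = trans (move (+ i) (q ℤ.* + r)) (cong (ℤ._- q ℤ.* + r) (sym (a≡a%ℕn+[a/ℕn]*n z r)))
    where
    move : ∀ x y → x ≡ (x ℤ.+ y) ℤ.- y
    move = solve-∀ℤ
  au≡1+reℤ : + a ℤ.* + u ≡ + 1 ℤ.+ + r ℤ.* + e
  au≡1+reℤ = begin
    + a ℤ.* + u        ≡⟨ pos-* a u ⟨
    + (a * u)          ≡⟨ cong +_ au≡1+re ⟩
    + (1 + r * e)      ≡⟨ pos-+ 1 (r * e) ⟩
    + 1 ℤ.+ + (r * e)  ≡⟨ cong (ℤ._+_ (+ 1)) (pos-* r e) ⟩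
    + 1 ℤ.+ + r ℤ.* + e ∎
  expand : ∀ A u a q r → a ℤ.* (ℤ.- (A ℤ.* u) ℤ.- q ℤ.* r) ℤ.+ A
                      ≡ ℤ.- (A ℤ.* (a ℤ.* u)) ℤ.- a ℤ.* q ℤ.* r ℤ.+ A
  expand = solve-∀ℤ
  collect : ∀ A a q r e → ℤ.- (A ℤ.* (+ 1 ℤ.+ r ℤ.* e)) ℤ.- a ℤ.* q ℤ.* r ℤ.+ A
                        ≡ (ℤ.- (A ℤ.* e) ℤ.- a ℤ.* q) ℤ.* r
  collect = solve-∀ℤ

positive-root : ∀ b r .{{_ : NonZero r}} → ¬ 3 ∣ r → ∃[ s ] (1 ≤ s × s ≤ r × + r ∣ℤ + 3 ℤ.* + s ℤ.+ b)
positive-root b r 3∤r = shift (solve-linear-congruence r (¬3∣⇒inverse-3 3∤r) b)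
  where
  shift : ∃[ s ] (s < r × + r ∣ℤ + 3 ℤ.* + s ℤ.+ b) → ∃[ s ] (1 ≤ s × s ≤ r × + r ∣ℤ + 3 ℤ.* + s ℤ.+ b)
  shift (zero , _ , r∣b) = r , ℕ.>-nonZero⁻¹ r , ≤-refl ,
    ℤ∣.∣m∣n⇒∣m+n (ℤ∣.∣n⇒∣m*n (+ 3) ℤ∣.∣-refl) (subst (_ ∣ℤ_) (ℤP.+-identityˡ b) r∣b)
  shift (suc s , s<r , r∣root) = suc s , s≤s z≤n , <⇒≤ s<r , r∣root

-- Differences of q_t

slope : ℤ → ℕ → ℕ → ℤ
slope b i d = + 6 ℤ.* + i ℤ.+ (+ 3 ℤ.* + d ℤ.+ b)

qt-difference : ∀ b c i d → qt b c i ℤ.- qt b c (i + d) ≡ ℤ.- (c ℤ.* + d ℤ.* slope b i d)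
qt-difference b c i d = begin
  qt b c i ℤ.- qt b c (i + d)
    ≡⟨ cong (λ x → qt b c i ℤ.- (+ 3 ℤ.* c ℤ.* x ℤ.* x ℤ.+ b ℤ.* c ℤ.* x)) (pos-+ i d) ⟩
  qt b c i ℤ.- (+ 3 ℤ.* c ℤ.* (+ i ℤ.+ + d) ℤ.* (+ i ℤ.+ + d) ℤ.+ b ℤ.* c ℤ.* (+ i ℤ.+ + d))
    ≡⟨ factor b c (+ i) (+ d) ⟩
  ℤ.- (c ℤ.* + d ℤ.* slope b i d) ∎
  where
  open ≡-Reasoning
  factor : ∀ b c x y → (+ 3 ℤ.* c ℤ.* x ℤ.* x ℤ.+ b ℤ.* c ℤ.* x)
                         ℤ.- (+ 3 ℤ.* c ℤ.* (x ℤ.+ y) ℤ.* (x ℤ.+ y) ℤ.+ b ℤ.* c ℤ.* (x ℤ.+ y))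
                       ≡ ℤ.- (c ℤ.* y ℤ.* (+ 6 ℤ.* x ℤ.+ (+ 3 ℤ.* y ℤ.+ b)))
  factor = solve-∀ℤ

∣qt-difference∣ : ∀ b c i d → ∣ qt b c i ℤ.- qt b c (i + d) ∣ ≡ ∣ c ∣ * d * ∣ slope b i d ∣
∣qt-difference∣ b c i d = begin
  ∣ qt b c i ℤ.- qt b c (i + d) ∣       ≡⟨ cong ∣_∣ (qt-difference b c i d) ⟩
  ∣ ℤ.- (c ℤ.* + d ℤ.* slope b i d) ∣   ≡⟨ ∣-i∣≡∣i∣ (c ℤ.* + d ℤ.* slope b i d) ⟩
  ∣ c ℤ.* + d ℤ.* slope b i d ∣         ≡⟨ abs-* (c ℤ.* + d) (slope b i d) ⟩
  ∣ c ℤ.* + d ∣ * ∣ slope b i d ∣       ≡⟨ cong (_* ∣ slope b i d ∣) (abs-* c (+ d)) ⟩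
  ∣ c ∣ * d * ∣ slope b i d ∣           ∎
  where open ≡-Reasoning

∣⇒qt-congruent : ∀ {b c m} i d → m ∣ ∣ c ∣ * d * ∣ slope b i d ∣ → qt b c i ≡ qt b c (i + d) [mod m ]
∣⇒qt-congruent {b} {c} i d = subst (_ ∣_) (sym (∣qt-difference∣ b c i d))

¬3∣slope : ∀ {b} i d → ¬ 3 ∣ ∣ b ∣ → ¬ 3 ∣ ∣ slope b i d ∣
¬3∣slope {b} i d 3∤b 3∣slope = 3∤b (ℤ∣.∣⇒∣ᵤ (subst (_ ∣ℤ_) (b≡slope-3[2i+d] (+ i) (+ d) b)
  (ℤ∣.∣m∣n⇒∣m-n {+ 3} {slope b i d} (ℤ∣.∣ᵤ⇒∣ 3∣slope) (ℤ∣.∣n⇒∣m*n (+ 2 ℤ.* + i ℤ.+ + d) ℤ∣.∣-refl))))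
  where
  b≡slope-3[2i+d] : ∀ i d b → + 6 ℤ.* i ℤ.+ (+ 3 ℤ.* d ℤ.+ b) ℤ.- (+ 2 ℤ.* i ℤ.+ d) ℤ.* + 3 ≡ b
  b≡slope-3[2i+d] = solve-∀ℤ

qt-incongruent-mod-3^ : ∀ {b c} e n → ¬ 3 ∣ ∣ b ∣ → ¬ 3 ∣ ∣ c ∣ → n ≤ 3 ^ e
                      → PairwiseIncongruent (qt b c) n (3 ^ e)
qt-incongruent-mod-3^ {b} {c} e n 3∤b 3∤c n≤3ᵉ i j _ j<n i<j congruent =
  <⇒≱ (<-≤-trans (≤-<-trans (m∸n≤m j i) j<n) n≤3ᵉ) (∣⇒≤ {{ℕ.>-nonZero 0<d}} 3ᵉ∣d)
  where
  d = j ∸ i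
  0<d : 0 < d
  0<d = m<n⇒0<n∸m i<j
  3ᵉ∣|qt-difference| : 3 ^ e ∣ ∣ qt b c i ℤ.- qt b c (i + d) ∣
  3ᵉ∣|qt-difference| = subst (λ x → 3 ^ e ∣ ∣ qt b c i ℤ.- qt b c x ∣) (sym (m+[n∸m]≡n (<⇒≤ i<j))) congruent
  3∤c·slope : ¬ 3 ∣ ∣ c ∣ * ∣ slope b i d ∣
  3∤c·slope 3∣ with euclidsLemma ∣ c ∣ ∣ slope b i d ∣ prime[3] 3∣
  ... | inj₁ 3∣c = 3∤c 3∣c
  ... | inj₂ 3∣slope = ¬3∣slope i d 3∤b 3∣slope
  3ᵉ∣d : 3 ^ e ∣ d
  3ᵉ∣d = prime^∣*⇒∣ _ d e prime[3] 3∤c·slope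
    (subst (3 ^ e ∣_) (trans (∣qt-difference∣ b c i d) (xy∙z≈xz∙y (∣ c ∣) d (∣ slope b i d ∣))) 3ᵉ∣|qt-difference|)

pos-1+2* : ∀ h → + (1 + 2 * h) ≡ + 1 ℤ.+ + 2 ℤ.* + h
pos-1+2* h = trans (pos-+ 1 (2 * h)) (cong (ℤ._+_ (+ 1)) (pos-* 2 h))

¬2∣∣b∣⇒b≡1+2q : ∀ {b} → ¬ 2 ∣ ∣ b ∣ → ∃[ q ] b ≡ + 1 ℤ.+ + 2 ℤ.* q
¬2∣∣b∣⇒b≡1+2q {+ n} 2∤b with ¬2∣⇒odd n 2∤b
... | h , refl = + h , pos-1+2* h
¬2∣∣b∣⇒b≡1+2q { -[1+ n ]} 2∤b with ¬2∣⇒odd (suc n) 2∤b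
... | h , 1+n≡1+2h = ℤ.- (+ 1 ℤ.+ + h) , (begin
  ℤ.- + suc n                          ≡⟨ cong (λ x → ℤ.- (+ x)) 1+n≡1+2h ⟩
  ℤ.- + (1 + 2 * h)                    ≡⟨ cong ℤ.-_ (pos-1+2* h) ⟩
  ℤ.- (+ 1 ℤ.+ + 2 ℤ.* + h)            ≡⟨ negate (+ h) ⟩
  + 1 ℤ.+ + 2 ℤ.* ℤ.- (+ 1 ℤ.+ + h)    ∎)
  where
  open ≡-Reasoning
  negate : ∀ h → ℤ.- (+ 1 ℤ.+ + 2 ℤ.* h) ≡ + 1 ℤ.+ + 2 ℤ.* ℤ.- (+ 1 ℤ.+ h)
  negate = solve-∀ℤ

slope-sum : ∀ b i d → slope b i d ≡ + 3 ℤ.* + (d + 2 * i) ℤ.+ b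
slope-sum b i d = begin
  slope b i d                           ≡⟨ regroup (+ i) (+ d) b ⟩
  + 3 ℤ.* (+ d ℤ.+ + 2 ℤ.* + i) ℤ.+ b   ≡⟨ cong (λ x → + 3 ℤ.* x ℤ.+ b) pos-d+2i ⟨
  + 3 ℤ.* + (d + 2 * i) ℤ.+ b           ∎
  where
  open ≡-Reasoning
  regroup : ∀ i d b → + 6 ℤ.* i ℤ.+ (+ 3 ℤ.* d ℤ.+ b) ≡ + 3 ℤ.* (d ℤ.+ + 2 ℤ.* i) ℤ.+ b
  regroup = solve-∀ℤ
  pos-d+2i : + (d + 2 * i) ≡ + d ℤ.+ + 2 ℤ.* + i
  pos-d+2i = trans (pos-+ d (2 * i)) (cong (ℤ._+_ (+ d)) (pos-* 2 i))

sum-root⇒slope-root : ∀ {b m s} i d → s ≡ d + 2 * i → + m ∣ℤ + 3 ℤ.* + s ℤ.+ b → m ∣ ∣ slope b i d ∣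
sum-root⇒slope-root {b} i d refl m∣root = ℤ∣.∣⇒∣ᵤ (subst (_ ∣ℤ_) (sym (slope-sum b i d)) m∣root)

odd-b⇒2∣3^[1+a]+b : ∀ {b} a → ¬ 2 ∣ ∣ b ∣ → + 2 ∣ℤ + 3 ℤ.* + 3 ^ a ℤ.+ b
odd-b⇒2∣3^[1+a]+b {b} a 2∤b with ¬2∣⇒odd (3 ^ suc a) (¬2∣3^ (suc a)) | ¬2∣∣b∣⇒b≡1+2q {b} 2∤b
... | h , 3^[1+a]≡1+2h | q , b≡1+2q = ℤ∣.divides (+ 1 ℤ.+ + h ℤ.+ q) (begin
  + 3 ℤ.* + 3 ^ a ℤ.+ b                       ≡⟨ cong₂ ℤ._+_ 3^[1+a]-odd b≡1+2q ⟩
  + 1 ℤ.+ + 2 ℤ.* + h ℤ.+ (+ 1 ℤ.+ + 2 ℤ.* q) ≡⟨ pair (+ h) q ⟩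
  (+ 1 ℤ.+ + h ℤ.+ q) ℤ.* + 2                  ∎)
  where
  open ≡-Reasoning
  3^[1+a]-odd : + 3 ℤ.* + 3 ^ a ≡ + 1 ℤ.+ + 2 ℤ.* + h
  3^[1+a]-odd = trans (sym (pos-* 3 (3 ^ a))) (trans (cong +_ 3^[1+a]≡1+2h) (pos-1+2* h))
  pair : ∀ h q → + 1 ℤ.+ + 2 ℤ.* h ℤ.+ (+ 1 ℤ.+ + 2 ℤ.* q) ≡ (+ 1 ℤ.+ h ℤ.+ q) ℤ.* + 2
  pair = solve-∀ℤ

even-b⇒2∣3*[2y]+b : ∀ {b} y → + 2 ∣ℤ b → + 2 ∣ℤ + 3 ℤ.* + (2 * y) ℤ.+ b
even-b⇒2∣3*[2y]+b y 2∣b =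
  ℤ∣.∣m∣n⇒∣m+n (ℤ∣.∣n⇒∣m*n (+ 3) (ℤ∣.∣ᵤ⇒∣ {+ 2} {+ (2 * y)} (m∣m*n y))) 2∣b

2∣3d+b⇒2∣slope : ∀ {b d} i → + 2 ∣ℤ + 3 ℤ.* + d ℤ.+ b → 2 ∣ ∣ slope b i d ∣
2∣3d+b⇒2∣slope i 2∣3d+b =
  ℤ∣.∣⇒∣ᵤ (ℤ∣.∣m∣n⇒∣m+n (ℤ∣.∣m⇒∣m*n {+ 2} {+ 6} (+ i) (ℤ∣.∣ᵤ⇒∣ (divides 3 refl))) 2∣3d+b)

odd-slope-root : ∀ b d {r} → ¬ 2 ∣ r → ¬ 3 ∣ r → ∃[ i ] (i < r × r ∣ ∣ slope b i d ∣)
odd-slope-root b d {r} 2∤r 3∤r =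
  map₂ (map₂ ℤ∣.∣⇒∣ᵤ) (solve-linear-congruence r {{ℕ.≢-nonZero r≢0}} inverse-6 (+ 3 ℤ.* + d ℤ.+ b))
  where
  r≢0 : r ≢ 0
  r≢0 refl = 2∤r (2 ∣0)
  inverse-6 : HasInverseMod 6 r
  inverse-6 with ¬2∣⇒odd r 2∤r
  ... | h , refl = inverse-* (inverse-2 h) (¬3∣⇒inverse-3 3∤r)

even-slope-root : ∀ b d {h} .{{_ : NonZero h}} → ¬ 3 ∣ h → + 2 ∣ℤ + 3 ℤ.* + d ℤ.+ b
                → ∃[ i ] (i < h × 2 * h ∣ ∣ slope b i d ∣)
even-slope-root b d {h} 3∤h (ℤ∣.divides B 3d+b≡B*2) =
  double (solve-linear-congruence h (¬3∣⇒inverse-3 3∤h) B)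
  where
  double : ∃[ i ] (i < h × + h ∣ℤ + 3 ℤ.* + i ℤ.+ B) → ∃[ i ] (i < h × 2 * h ∣ ∣ slope b i d ∣)
  double (i , i<h , h∣3i+B) = i , i<h , subst₂ _∣_ (*-comm h 2) |slope| (*-monoˡ-∣ 2 (ℤ∣.∣⇒∣ᵤ h∣3i+B))
    where
    |slope| : ∣ + 3 ℤ.* + i ℤ.+ B ∣ * 2 ≡ ∣ slope b i d ∣
    |slope| = begin
      ∣ + 3 ℤ.* + i ℤ.+ B ∣ * 2              ≡⟨ abs-* (+ 3 ℤ.* + i ℤ.+ B) (+ 2) ⟨
      ∣ (+ 3 ℤ.* + i ℤ.+ B) ℤ.* + 2 ∣        ≡⟨ cong ∣_∣ (regroup (+ i) B) ⟩
      ∣ + 6 ℤ.* + i ℤ.+ B ℤ.* + 2 ∣          ≡⟨ cong (λ x → ∣ + 6 ℤ.* + i ℤ.+ x ∣) 3d+b≡B*2 ⟨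
      ∣ slope b i d ∣                         ∎
      where
      open ≡-Reasoning
      regroup : ∀ i B → (+ 3 ℤ.* i ℤ.+ B) ℤ.* + 2 ≡ + 6 ℤ.* i ℤ.+ B ℤ.* + 2
      regroup = solve-∀ℤ

3s+β≡l*M⇒l≡3 : ∀ {K M s β l} → 2 * K ≤ s → s ≤ M → β < M → M < 3 * K → 3 * s + β ≡ l * M → l ≡ 3
3s+β≡l*M⇒l≡3 {K} {M} {s} {β} {l} 2K≤s s≤M β<M M<3K 3s+β≡lM = between (*-cancelʳ-< M 2 l 2M<lM) (*-cancelʳ-< M l 4 lM<4M)
  where
  open ≤-Reasoning
  2M<lM : 2 * M < l * M
  2M<lM = begin-strict
    2 * M         <⟨ *-monoʳ-< 2 M<3K ⟩
    2 * (3 * K)   ≡⟨ x∙yz≈y∙xz 2 3 K ⟩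
    3 * (2 * K)   ≤⟨ *-monoʳ-≤ 3 2K≤s ⟩
    3 * s         ≤⟨ m≤m+n (3 * s) β ⟩
    3 * s + β     ≡⟨ 3s+β≡lM ⟩
    l * M         ∎
  lM<4M : l * M < 4 * M
  lM<4M = begin-strict
    l * M         ≡⟨ 3s+β≡lM ⟨
    3 * s + β     <⟨ +-mono-≤-< (*-monoʳ-≤ 3 s≤M) β<M ⟩
    3 * M + M     ≡⟨ +-comm (3 * M) M ⟩
    4 * M         ∎
  between : 2 < l → l < 4 → l ≡ 3
  between (s≤s (s≤s (s≤s z≤n))) (s≤s (s≤s (s≤s (s≤s z≤n)))) = refl

root⇒M∣3s+b%M : ∀ {b M s} .{{_ : NonZero M}} → + M ∣ℤ + 3 ℤ.* + s ℤ.+ b → M ∣ 3 * s + b %ℕ M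
root⇒M∣3s+b%M {b} {M} {s} M∣ =
  ℤ∣.∣⇒∣ᵤ (subst (+ M ∣ℤ_) (sym residue-form) (ℤ∣.∣m∣n⇒∣m-n M∣ (ℤ∣.∣n⇒∣m*n (b /ℕ M) ℤ∣.∣-refl)))
  where
  residue-form : + (3 * s + b %ℕ M) ≡ (+ 3 ℤ.* + s ℤ.+ b) ℤ.- (b /ℕ M) ℤ.* + M
  residue-form = begin
    + (3 * s + b %ℕ M)
      ≡⟨ pos-+ (3 * s) (b %ℕ M) ⟩
    + (3 * s) ℤ.+ + (b %ℕ M)
      ≡⟨ cong (ℤ._+ + (b %ℕ M)) (pos-* 3 s) ⟩
    + 3 ℤ.* + s ℤ.+ + (b %ℕ M)
      ≡⟨ cancel (+ 3 ℤ.* + s) (+ (b %ℕ M)) ((b /ℕ M) ℤ.* + M) ⟩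
    (+ 3 ℤ.* + s ℤ.+ (+ (b %ℕ M) ℤ.+ (b /ℕ M) ℤ.* + M)) ℤ.- (b /ℕ M) ℤ.* + M
      ≡⟨ cong (λ x → (+ 3 ℤ.* + s ℤ.+ x) ℤ.- (b /ℕ M) ℤ.* + M) (a≡a%ℕn+[a/ℕn]*n b M) ⟨
    (+ 3 ℤ.* + s ℤ.+ b) ℤ.- (b /ℕ M) ℤ.* + M ∎
    where
    open ≡-Reasoning
    cancel : ∀ x y z → x ℤ.+ y ≡ (x ℤ.+ (y ℤ.+ z)) ℤ.- z
    cancel = solve-∀ℤ

-- If |b| < M then b mod M is b itself, excluded by 3 ∤ b, or M + b for b ∈ {−1, −2}, which is too large
-- for the margin; for b = −2 this uses M + 2 ≤ 3K, as M is odd while 3K − 1 is even.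
small-residue⇒M≤∣b∣ : ∀ {K M} b → -[1+ 1 ] ℤ.≤ b → ¬ 3 ∣ ∣ b ∣ → ¬ 2 ∣ K → (¬ 2 ∣ M) ⊎ (¬ 2 ∣ (∣ b ∣))
  → M < 3 * K → 3 ∣ b modN M → (∀ j → M + j ≤ 3 * K → 2 * j + b modN M ≤ M) → M ≤ ∣ b ∣
small-residue⇒M≤∣b∣ {M = zero} _ _ _ _ _ _ _ _ = z≤n
small-residue⇒M≤∣b∣ {M = M@(suc _)} (+ n) _ 3∤b _ _ _ 3∣β _ with M ≤? n
... | yes M≤n = M≤n
... | no M≰n = contradiction (subst (3 ∣_) (m<n⇒m%n≡m (≰⇒> M≰n)) 3∣β) 3∤b
small-residue⇒M≤∣b∣ {M = 1} -[1+ 0 ] _ _ _ _ _ _ _ = ≤-refl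
small-residue⇒M≤∣b∣ {K} {M@(suc (suc _))} -[1+ 0 ] _ _ _ _ M<3K _ margin =
  contradiction (margin 1 (subst (_≤ 3 * K) (+-comm 1 M) M<3K)) 1+n≰n
small-residue⇒M≤∣b∣ {M = 1} -[1+ 1 ] _ _ _ _ _ _ _ = s≤s z≤n
small-residue⇒M≤∣b∣ {M = 2} -[1+ 1 ] _ _ _ _ _ _ _ = ≤-refl
small-residue⇒M≤∣b∣ {M = suc (suc (suc _))} -[1+ 1 ] _ _ _ (inj₂ 2∤2) _ _ _ = contradiction ∣-refl 2∤2
small-residue⇒M≤∣b∣ {K} {M@(suc (suc (suc _)))} -[1+ 1 ] _ _ 2∤K (inj₁ 2∤M) M<3K _ margin =
  contradiction (margin 2 M+2≤3K) (λ 5+M≤3+M → 1+n≰n (≤-trans (n≤1+n _) 5+M≤3+M))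
  where
  2∤3K : ¬ 2 ∣ 3 * K
  2∤3K 2∣3K with euclidsLemma 3 K prime[2] 2∣3K
  ... | inj₁ 2∣3 = toWitnessFalse {a? = 2 ∣? 3} _ 2∣3
  ... | inj₂ 2∣K = 2∤K 2∣K
  1+M≢3K : suc M ≢ 3 * K
  1+M≢3K 1+M≡3K with ¬2∣⇒odd M 2∤M
  ... | h , M≡1+2h = 2∤3K (divides (suc h) (trans (sym 1+M≡3K) (trans (cong suc M≡1+2h) (cong (_+_ 2) (*-comm 2 h)))))
  M+2≤3K : M + 2 ≤ 3 * K
  M+2≤3K = subst (_≤ 3 * K) (+-comm 2 M) (≤∧≢⇒< M<3K 1+M≢3K)
small-residue⇒M≤∣b∣ -[1+ suc (suc _) ] (ℤ.-≤- (s≤s ()))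

-- 3s + (b mod M) is a multiple of M strictly between 2M and 4M, hence equal to 3M.
large-root⇒3∣b%M∧M≤∣b∣ :
  ∀ {b K M s} → -[1+ 1 ] ℤ.≤ b → ¬ 3 ∣ ∣ b ∣ → ¬ 2 ∣ K → (¬ 2 ∣ M) ⊎ (¬ 2 ∣ (∣ b ∣))
  → 2 * K ≤ s → s ≤ M → M < 3 * K → + M ∣ℤ + 3 ℤ.* + s ℤ.+ b
  → 3 ∣ b modN M × M ≤ ∣ b ∣
large-root⇒3∣b%M∧M≤∣b∣ {K = zero} _ _ 2∤K = contradiction (2 ∣0) 2∤K
large-root⇒3∣b%M∧M≤∣b∣ {K = suc _} {zero} _ _ _ _ 2K≤s s≤M = contradiction (≤-trans 2K≤s s≤M) λ ()
large-root⇒3∣b%M∧M≤∣b∣ {b} {K@(suc _)} {M@(suc _)} {s} b≥-2 3∤b 2∤K parity 2K≤s s≤M M<3K M∣root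
  with root⇒M∣3s+b%M {b} {M} {s} M∣root
... | divides l 3s+β≡lM = 3∣β , small-residue⇒M≤∣b∣ b b≥-2 3∤b 2∤K parity M<3K 3∣β margin
  where
  β = b modN M
  3s+β≡3M : 3 * s + β ≡ 3 * M
  3s+β≡3M = trans 3s+β≡lM (cong (_* M) (3s+β≡l*M⇒l≡3 {K} {M} {s} {β} {l} 2K≤s s≤M (n%ℕd<d b M) M<3K 3s+β≡lM))
  3∣β : 3 ∣ β
  3∣β = ∣m+n∣m⇒∣n (subst (3 ∣_) (sym 3s+β≡3M) (m∣m*n M)) (m∣m*n s)
  margin : ∀ j → M + j ≤ 3 * K → 2 * j + β ≤ M
  margin j M+j≤3K = +-cancelˡ-≤ (2 * M) (2 * j + β) M (begin
    2 * M + (2 * j + β)   ≡⟨ regroup M j β ⟩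
    2 * (M + j) + β       ≤⟨ +-monoˡ-≤ β (*-monoʳ-≤ 2 M+j≤3K) ⟩
    2 * (3 * K) + β       ≡⟨ cong (_+ β) (x∙yz≈y∙xz 2 3 K) ⟩
    3 * (2 * K) + β       ≤⟨ +-monoˡ-≤ β (*-monoʳ-≤ 3 2K≤s) ⟩
    3 * s + β             ≡⟨ 3s+β≡3M ⟩
    3 * M                 ≡⟨ +-comm M (2 * M) ⟩
    2 * M + M             ∎)
    where
    open ≤-Reasoning
    regroup : ∀ M j β → 2 * M + (2 * j + β) ≡ 2 * (M + j) + β
    regroup = solve-∀

-- Collisions below the next power of 3

CollisionUpTo : ℤ → ℤ → ℕ → ℕ → Set
CollisionUpTo b c K m = ∃[ i ] ∃[ d ] (1 ≤ d × i + d ≤ K × qt b c i ≡ qt b c (i + d) [mod m ])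

collision⇒¬incongruent : ∀ {b c K n m} → K < n → CollisionUpTo b c K m → ¬ PairwiseIncongruent (qt b c) n m
collision⇒¬incongruent K<n (i , d , 1≤d , i+d≤K , congruent) incongruent =
  incongruent i (i + d) (≤-<-trans (m≤m+n i d) i+d<n) i+d<n (m<m+n i 1≤d) congruent
  where
  i+d<n = ≤-<-trans i+d≤K K<n

trivial-collision : ∀ {b c m} → 1 ≤ m → CollisionUpTo b c m m
trivial-collision {b} {c} {m} 1≤m =
  0 , m , 1≤m , ≤-refl , ∣⇒qt-congruent {b} {c} 0 m (∣m⇒∣m*n (∣ slope b 0 m ∣) (n∣m*n ∣ c ∣))

-- Hypotheses (4) and (5) of the theorem; (+ m) ℤD.∣ x unfolds to m ∣ ∣ x ∣.
PowerOfTwoCondition : ℤ → ℤ → Set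
PowerOfTwoCondition b c =
  ¬ 2 ∣ ∣ b ∣
  → (∃[ x ] ∃[ k ] (1 ≤ x × 1 ≤ k × 2 * 3 ^ k < 2 ^ x × 2 ^ x < 3 ^ suc k
                   × 2 ^ x ≤ ∣ b ∣ × 3 ∣ b modN (2 ^ x)))
  → 2 ∣ ∣ c ∣

PrimeCondition : ℤ → ℤ → Set
PrimeCondition b c =
  ∀ p → Prime p → (∃[ k ] (1 ≤ k × 2 * 3 ^ k < p × p < 3 ^ suc k))
  → p ≤ ∣ b ∣ → 3 ∣ b modN p → p ∣ ∣ c ∣

module Collisions (b c : ℤ) (b≥-2 : -[1+ 1 ] ℤ.≤ b) (3∤b : ¬ 3 ∣ ∣ b ∣)
                  (b-even⇒c-even : 2 ∣ ∣ b ∣ → 2 ∣ ∣ c ∣)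
                  (condition₄ : PowerOfTwoCondition b c) (condition₅ : PrimeCondition b c)
                  (k : ℕ) where

  K : ℕ
  K = 3 ^ k

  Collision : ℕ → Set
  Collision = CollisionUpTo b c K

  collides : ∀ {m} i d → 1 ≤ d → i + d ≤ K → m ∣ ∣ c ∣ * d * ∣ slope b i d ∣ → Collision m
  collides i d 1≤d i+d≤K m∣ = i , d , 1≤d , i+d≤K , ∣⇒qt-congruent {b} {c} i d m∣

  divisor-of-c-collision : ∀ {g} d → g ∣ ∣ c ∣ → 1 ≤ d → d ≤ K → Collision (g * d)
  divisor-of-c-collision {g} d g∣c 1≤d d≤K =
    collides 0 d 1≤d d≤K (∣m⇒∣m*n (∣ slope b 0 d ∣) (*-pres-∣ g∣c (∣-refl {d})))

  prime-collision : ∀ {p} → Prime p → 5 ≤ p → K < p → p < 3 * K → Collision p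
  prime-collision {p} pp 5≤p K<p p<3K = from-root (positive-root b p {{prime⇒nonZero pp}} (prime≥5⇒¬3∣ pp 5≤p))
    where
    from-root : ∃[ s ] (1 ≤ s × s ≤ p × + p ∣ℤ + 3 ℤ.* + s ℤ.+ b) → Collision p
    from-root (s , 1≤s , s≤p , p∣root) with s <? 2 * K
    ... | yes s<2K = small (split-sum 1≤s s<2K)
      where
      small : ∃[ i ] ∃[ d ] ((d ≡ 1 ⊎ d ≡ 2) × s ≡ d + 2 * i × i + d ≤ K) → Collision p
      small (i , d , d∈ , s≡ , i+d≤K) =
        collides i d (1≤d d∈) i+d≤K (∣n⇒∣m*n (∣ c ∣ * d) (sum-root⇒slope-root i d s≡ p∣root))
        where
        1≤d : ∀ {d} → d ≡ 1 ⊎ d ≡ 2 → 1 ≤ d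
        1≤d (inj₁ refl) = s≤s z≤n
        1≤d (inj₂ refl) = s≤s z≤n
    ... | no s≮2K = subst Collision (*-identityʳ p) (divisor-of-c-collision 1 p∣c ≤-refl (m^n>0 3 k))
      where
      2∤p = prime≥5⇒¬2∣ pp 5≤p
      2K≤s = ≮⇒≥ s≮2K
      2K<p : 2 * K < p
      2K<p = ≤∧≢⇒< (≤-trans 2K≤s s≤p) (λ 2K≡p → 2∤p (subst (2 ∣_) 2K≡p (m∣m*n K)))
      3∣b%p×p≤∣b∣ = large-root⇒3∣b%M∧M≤∣b∣ b≥-2 3∤b (¬2∣3^ k) (inj₁ 2∤p) 2K≤s s≤p p<3K p∣root
      p∣c : p ∣ ∣ c ∣
      p∣c = condition₅ p pp (k , 2*3^k<x<3^[1+k]⇒1≤k 2K<p p<3K , 2K<p , p<3K)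
                        (proj₂ 3∣b%p×p≤∣b∣) (proj₁ 3∣b%p×p≤∣b∣)

  twice-prime-collision : ∀ {p} → Prime p → 5 ≤ p → 2 * p < 3 * K → Collision (2 * p)
  twice-prime-collision {p} pp 5≤p 2p<3K = from-root (positive-root b p {{prime⇒nonZero pp}} (prime≥5⇒¬3∣ pp 5≤p))
    where
    from-root : ∃[ s ] (1 ≤ s × s ≤ p × + p ∣ℤ + 3 ℤ.* + s ℤ.+ b) → Collision (2 * p)
    from-root (s , 1≤s , s≤p , p∣root) = small (split-sum 1≤s (≤-<-trans s≤p (2*x<3*K⇒x<2*K {p} {K} 2p<3K)))
      where
      small : ∃[ i ] ∃[ d ] ((d ≡ 1 ⊎ d ≡ 2) × s ≡ d + 2 * i × i + d ≤ K) → Collision (2 * p)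
      small (i , 1 , inj₁ refl , s≡ , i+1≤K) = collides i 1 (s≤s z≤n) i+1≤K
        (prime∣∧∣⇒*∣ prime[2] (prime≥5⇒¬2∣ pp 5≤p) 2∣c·slope
                     (∣n⇒∣m*n (∣ c ∣ * 1) (sum-root⇒slope-root i 1 s≡ p∣root)))
        where
        2∣c·slope : 2 ∣ ∣ c ∣ * 1 * ∣ slope b i 1 ∣
        2∣c·slope with 2 ∣? ∣ b ∣
        ... | yes 2∣b = ∣m⇒∣m*n _ (∣m⇒∣m*n 1 (b-even⇒c-even 2∣b))
        ... | no 2∤b = ∣n⇒∣m*n (∣ c ∣ * 1) (2∣3d+b⇒2∣slope {b} {1} i (odd-b⇒2∣3^[1+a]+b {b} 0 2∤b))
      small (i , 2 , inj₂ refl , s≡ , i+2≤K) = collides i 2 (s≤s z≤n) i+2≤K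
        (*-pres-∣ (n∣m*n ∣ c ∣) (sum-root⇒slope-root i 2 s≡ p∣root))

  rough-collision : ∀ u {p} → Prime p → 5 ≤ p → K < u * p → u * p < 3 * K → Collision (u * p)
  rough-collision 0 _ _ K<0 _ = contradiction K<0 n≮0
  rough-collision 1 {p} pp 5≤p K<p p<3K = subst Collision (sym (*-identityˡ p))
    (prime-collision pp 5≤p (subst (K <_) (*-identityˡ p) K<p) (subst (_< 3 * K) (*-identityˡ p) p<3K))
  rough-collision 2 pp 5≤p _ 2p<3K = twice-prime-collision pp 5≤p 2p<3K
  rough-collision u@(suc (suc (suc _))) {p} pp 5≤p _ up<3K =
    from-root (odd-slope-root b u (prime≥5⇒¬2∣ pp 5≤p) (prime≥5⇒¬3∣ pp 5≤p))
    where
    from-root : ∃[ i ] (i < p × p ∣ ∣ slope b i u ∣) → Collision (u * p)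
    from-root (i , i<p , p∣slope) = collides i u (s≤s z≤n)
      (i<r⇒d+r≤1+K⇒i+d≤K i<p (u*p<3^[1+k]⇒u+p≤1+3^k k (s≤s (s≤s (s≤s z≤n))) 5≤p (prime≥5⇒¬2∣ pp 5≤p) up<3K))
      (*-pres-∣ (n∣m*n ∣ c ∣) p∣slope)

  -- A root i ≥ K is the situation of hypothesis (4); with c even, half of the modulus suffices.
  exceptional-power-of-two-collision : ∀ w {i} → ¬ 2 ∣ ∣ b ∣ → K ≤ i → i < 2 ^ w → 2 * 2 ^ w < 3 * K
    → 2 * 2 ^ w ∣ ∣ slope b i 1 ∣ → Collision (2 * 2 ^ w)
  exceptional-power-of-two-collision zero _ K≤i (s≤s i≤0) = contradiction (≤-trans (m^n>0 3 k) (≤-trans K≤i i≤0)) λ ()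
  exceptional-power-of-two-collision (suc w) {i} 2∤b K≤i i<h M<3K M∣slope =
    from-root (even-slope-root b 1 {2 ^ w} {{m^n≢0 2 w}} (¬3∣2^ w) (odd-b⇒2∣3^[1+a]+b {b} 0 2∤b))
    where
    M = 2 ^ suc (suc w)
    2K<M : 2 * K < M
    2K<M = ≤-<-trans (*-monoʳ-≤ 2 K≤i) (*-monoʳ-< 2 i<h)
    root : + M ∣ℤ + 3 ℤ.* + (1 + 2 * i) ℤ.+ b
    root = ℤ∣.∣ᵤ⇒∣ (subst (M ∣_) (cong ∣_∣ (slope-sum b i 1)) M∣slope)
    1+2i≤M : 1 + 2 * i ≤ M
    1+2i≤M = ≤-trans (n≤1+n _) (subst (_≤ M) (*-suc 2 i) (*-monoʳ-≤ 2 i<h))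
    3∣b%M×M≤∣b∣ = large-root⇒3∣b%M∧M≤∣b∣ b≥-2 3∤b (¬2∣3^ k) (inj₂ 2∤b)
                    (≤-trans (*-monoʳ-≤ 2 K≤i) (n≤1+n _)) 1+2i≤M M<3K root
    c-even : 2 ∣ ∣ c ∣
    c-even = condition₄ 2∤b (suc (suc w) , k , s≤s z≤n , 2*3^k<x<3^[1+k]⇒1≤k 2K<M M<3K , 2K<M , M<3K
                             , proj₂ 3∣b%M×M≤∣b∣ , proj₁ 3∣b%M×M≤∣b∣)
    from-root : ∃[ i′ ] (i′ < 2 ^ w × 2 * 2 ^ w ∣ ∣ slope b i′ 1 ∣) → Collision M
    from-root (i′ , i′<h′ , 2h′∣slope) = collides i′ 1 (s≤s z≤n)
      (subst (_≤ K) (+-comm 1 i′) (<-trans i′<h′ (4*x<3*K⇒x<K (subst (_< 3 * K) (sym (*-assoc 2 2 (2 ^ w))) M<3K))))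
      (*-pres-∣ (*-pres-∣ c-even (∣-refl {1})) 2h′∣slope)

  odd-b-smooth-collision : ∀ w a → ¬ 2 ∣ ∣ b ∣ → 2 ^ suc w * 3 ^ a < 3 * K → Collision (2 ^ suc w * 3 ^ a)
  odd-b-smooth-collision w a 2∤b m<3K =
    from-root (even-slope-root b (3 ^ a) {2 ^ w} {{m^n≢0 2 w}} (¬3∣2^ w) (odd-b⇒2∣3^[1+a]+b {b} a 2∤b))
    where
    from-root : ∃[ i ] (i < 2 ^ w × 2 ^ suc w ∣ ∣ slope b i (3 ^ a) ∣) → Collision (2 ^ suc w * 3 ^ a)
    from-root (i , i<h , 2h∣slope) with i + 3 ^ a ≤? K
    ... | yes i+d≤K = subst Collision (*-comm (3 ^ a) (2 ^ suc w))
      (collides i (3 ^ a) (m^n>0 3 a) i+d≤K (*-pres-∣ (n∣m*n ∣ c ∣) 2h∣slope))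
    ... | no i+d≰K = unbalanced a m<3K i+d≰K 2h∣slope
      where
      unbalanced : ∀ a → 2 ^ suc w * 3 ^ a < 3 * K → i + 3 ^ a ≰ K → 2 ^ suc w ∣ ∣ slope b i (3 ^ a) ∣
                 → Collision (2 ^ suc w * 3 ^ a)
      unbalanced (suc a) m<3K i+d≰K _ =
        contradiction (i<r⇒d+r≤1+K⇒i+d≤K i<h (2*2^w*3^[1+a]<3^[1+k]⇒3^[1+a]+2^w≤1+3^k k w a m<3K)) i+d≰K
      unbalanced zero m<3K i+1≰K 2h∣slope = subst Collision (sym (*-identityʳ (2 ^ suc w)))
        (exceptional-power-of-two-collision w 2∤b K≤i i<h (subst (_< 3 * K) (*-identityʳ (2 ^ suc w)) m<3K) 2h∣slope)
        where
        K≤i : K ≤ i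
        K≤i = ≤-pred (subst (K <_) (+-comm i 1) (≰⇒> i+1≰K))

  even-b-smooth-collision : ∀ w a → 2 ∣ ∣ c ∣ → + 2 ∣ℤ b → 2 ^ suc w * 3 ^ a < 3 * K → Collision (2 ^ suc w * 3 ^ a)
  even-b-smooth-collision zero a c-even _ m<3K =
    divisor-of-c-collision (3 ^ a) c-even (m^n>0 3 a) (3^<3^[1+k]⇒≤3^k {a} {k} (≤-<-trans (m≤n*m (3 ^ a) 2) m<3K))
  even-b-smooth-collision (suc zero) a c-even _ m<3K = subst Collision (sym (*-assoc 2 2 (3 ^ a)))
    (divisor-of-c-collision (2 * 3 ^ a) c-even (≤-trans (m^n>0 3 a) (m≤n*m (3 ^ a) 2)) 2·3ᵃ≤K)
    where
    3ᵃ⁺¹≤K : 3 ^ suc a ≤ K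
    3ᵃ⁺¹≤K = 3^<3^[1+k]⇒≤3^k {suc a} {k} (≤-<-trans (*-monoˡ-≤ (3 ^ a) (n≤1+n 3)) m<3K)
    2·3ᵃ≤K : 2 * 3 ^ a ≤ K
    2·3ᵃ≤K = ≤-trans (*-monoˡ-≤ (3 ^ a) (n≤1+n 2)) 3ᵃ⁺¹≤K
  even-b-smooth-collision (suc (suc w)) a c-even 2∣b m<3K =
    from-root (even-slope-root b (2 * 3 ^ a) {2 ^ w} {{m^n≢0 2 w}} (¬3∣2^ w) (even-b⇒2∣3*[2y]+b (3 ^ a) 2∣b))
    where
    from-root : ∃[ i ] (i < 2 ^ w × 2 * 2 ^ w ∣ ∣ slope b i (2 * 3 ^ a) ∣) → Collision (2 ^ suc (suc (suc w)) * 3 ^ a)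
    from-root (i , i<h , 2h∣slope) = subst Collision (regroup (2 ^ w) (3 ^ a))
      (collides i (2 * 3 ^ a) (≤-trans (m^n>0 3 a) (m≤n*m (3 ^ a) 2))
        (i<r⇒d+r≤1+K⇒i+d≤K i<h (8*x*y<3*K⇒2*y+x≤1+K (2 ^ w) (3 ^ a) (m^n>0 2 w) (m^n>0 3 a) m<3K))
        (*-pres-∣ (*-pres-∣ c-even (∣-refl {2 * 3 ^ a})) 2h∣slope))
      where
      regroup : ∀ x y → 2 * (2 * y) * (2 * x) ≡ 2 * (2 * (2 * x)) * y
      regroup = solve-∀

  smooth-collision : ∀ w a → K < 2 ^ w * 3 ^ a → 2 ^ w * 3 ^ a < 3 * K → Collision (2 ^ w * 3 ^ a)
  smooth-collision zero a K<m m<3K = contradiction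
    (3^<3^[1+k]⇒≤3^k {a} {k} (subst (_< 3 * K) (*-identityˡ (3 ^ a)) m<3K)) (<⇒≱ (subst (K <_) (*-identityˡ (3 ^ a)) K<m))
  smooth-collision (suc w) a K<m m<3K with 2 ∣? ∣ b ∣
  ... | no 2∤b = odd-b-smooth-collision w a 2∤b m<3K
  ... | yes 2∣b = even-b-smooth-collision w a (b-even⇒c-even 2∣b) (ℤ∣.∣ᵤ⇒∣ 2∣b) m<3K

  collision : ∀ {m} → K < m → m < 3 * K → Collision m
  collision {m} K<m m<3K with 3-smooth⊎hasPrimeFactor≥5 m {{ℕ.>-nonZero (≤-<-trans z≤n K<m)}}
  ... | inj₁ (w , a , refl) = smooth-collision w a K<m m<3K
  ... | inj₂ (p , pp , 5≤p , divides u refl) = rough-collision u pp 5≤p K<m m<3K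

theorem24 : (b c : ℤ) → b ≢ + 0 → c ≢ + 0
    → -[1+ 1 ] ℤ.≤ b
    → ¬ ((+ 3) ℤD.∣ (b ℤ.* c))
    → ((+ 2) ℤD.∣ b → (+ 2) ℤD.∣ c)
    → (¬ ((+ 2) ℤD.∣ b)
        → (∃[ x ] ∃[ k ] (1 ≤ x × 1 ≤ k × 2 ℕ.* 3 ^ k < 2 ^ x × 2 ^ x < 3 ^ (ℕ.suc k)
             × 2 ^ x ≤ ∣ b ∣ × 3 ℕD.∣ (b modN (2 ^ x))))
        → (+ 2) ℤD.∣ c)
    → (∀ p → Prime p
        → (∃[ k ] (1 ≤ k × 2 ℕ.* 3 ^ k < p × p < 3 ^ (ℕ.suc k)))
        → p ≤ ∣ b ∣ → 3 ℕD.∣ (b modN p)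
        → (+ p) ℤD.∣ c)
    → ∀ n → 1 ≤ n → IsDiscriminator (qt b c) n (3 ^ ⌈log₃ n ⌉)
theorem24 b c _ _ b≥-2 3∤bc b-even⇒c-even condition₄ condition₅ n _ =
  m^n>0 3 ⌈log₃ n ⌉ , qt-incongruent-mod-3^ {b} {c} ⌈log₃ n ⌉ n 3∤b 3∤c (n≤3^⌈log₃n⌉ n) ,
  λ m 1≤m m<3ᵉ → not-discriminating ⌈log₃ n ⌉ (⌈log₃n⌉-minimal n) m 1≤m m<3ᵉ
  where
  3∤b : ¬ 3 ℕD.∣ ∣ b ∣
  3∤b 3∣b = 3∤bc (subst (3 ℕD.∣_) (sym (abs-* b c)) (∣m⇒∣m*n ∣ c ∣ 3∣b))
  3∤c : ¬ 3 ℕD.∣ ∣ c ∣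
  3∤c 3∣c = 3∤bc (subst (3 ℕD.∣_) (sym (abs-* b c)) (∣n⇒∣m*n ∣ b ∣ 3∣c))
  not-discriminating : ∀ e → PreviousPowerBelow n e → ∀ m → 1 ≤ m → m < 3 ^ e → ¬ PairwiseIncongruent (qt b c) n m
  not-discriminating e below m 1≤m m<3ᵉ with m <? n
  ... | yes m<n = collision⇒¬incongruent {b} {c} m<n (trivial-collision {b} {c} 1≤m)
  not-discriminating zero _ m 1≤m m<1 | no _ = contradiction 1≤m (<⇒≱ m<1)
  not-discriminating (suc k) below m _ m<3ᵏ⁺¹ | no m≮n = collision⇒¬incongruent {b} {c} 3ᵏ<n
    (Collisions.collision b c b≥-2 3∤b b-even⇒c-even condition₄ condition₅ k (<-≤-trans 3ᵏ<n (≮⇒≥ m≮n)) m<3ᵏ⁺¹)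
    where
    3ᵏ<n = below refl
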